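{- Let $h,j,k$ be positive integers with $k<j$, and consider solutions $(n_1,\ldots,n_h)$ in pairwise distinct positive integers $n_1,\ldots,n_h\le j$ of the equation $$2(n_1+n_2+\cdots+n_h)-(kj+h)=0.$$ Then: (i) if $j<3$ or $k\ge 2h$, there is no solution; (ii) if $k_1$ is a positive integer with $k_1<h<j$ and there are exactly $M$ solutions for $k=k_1$ (with $j$ and $h$ fixed), then there are exactly $M$ solutions for $k=k_2:=2h-k_1$ (with the same $j$ and $h$). -}

module Defs where

open import Data.Nat using (ℕ; zero; suc; _+_; _*_; _≤_; _≟_)
open import Data.Nat.Properties using (_≤?_)
open import Data.Product using (_×_)
open import Data.List using (List; []; _∷_; map; concatMap; upTo; filter; length)
open import Data.Vec using (Vec; toList; sum)
import Data.Vec as V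
open import Data.Vec.Relation.Unary.All using (All)
import Data.Vec.Relation.Unary.All as AllV
open import Data.List.Relation.Unary.Unique.Propositional using (Unique)
import Data.List.Relation.Unary.Unique.Propositional.Properties as UP
open import Data.List.Relation.Unary.Unique.DecPropositional _≟_ using (unique?)
open import Relation.Binary.PropositionalEquality using (_≡_)
open import Relation.Nullary using (Dec)
open import Relation.Nullary.Decidable using (_×-dec_)

IsSolution : (h j k : ℕ) → Vec ℕ h → Set
IsSolution h j k v =
  Unique (toList v) × All (λ n → 1 ≤ n × n ≤ j) v × 2 * sum v ≡ k * j + h

isSolution? : (h j k : ℕ) → (v : Vec ℕ h) → Dec (IsSolution h j k v)
isSolution? h j k v =
  unique? (toList v) ×-dec (AllV.all? (λ n → (1 ≤? n) ×-dec (n ≤? j)) v ×-dec (2 * sum v ≟ k * j + h))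

tuples : (h : ℕ) → List ℕ → List (Vec ℕ h)
tuples zero    xs = V.[] ∷ []
tuples (suc h) xs = concatMap (λ x → map (x V.∷_) (tuples h xs)) xs

range1 : ℕ → List ℕ
range1 j = map suc (upTo j)

numSolutions : (h j k : ℕ) → ℕ
numSolutions h j k = length (filter (isSolution? h j k) (tuples h (range1 j)))

{-# OPTIONS --safe #-}

-- Reflecting every entry, n ↦ j + 1 − n, maps [1, j] onto itself and turns a
-- solution (n₁, …, nₕ) into a vector with sum h(j + 1) − (n₁ + ⋯ + nₕ), that is,
-- a solution of the equation for k₂ = 2h − k₁; since the reflection is an
-- involution it permutes the candidate tuples, so both counts agree.
-- If 2h ≤ k the equation cannot hold because 2(n₁ + ⋯ + nₕ) ≤ 2hj ≤ kj, and
-- j < 3 forces j = 2, k = 1, where distinct entries in {1, 2} are too few.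
module Submission where

open import Defs
open import Data.Nat using (ℕ; zero; suc; _+_; _*_; _∸_; _≤_; _<_; z≤n; s≤s)
open import Data.Nat.Properties
open import Data.Nat.Tactic.RingSolver using (solve-∀)
open import Data.Product using (Σ; _×_; _,_; proj₂)
open import Data.Sum using (_⊎_; inj₁; inj₂)
open import Data.Empty using (⊥-elim)
open import Data.Vec using (Vec; sum)
import Data.Vec as V
import Data.Vec.Properties as V
import Data.Vec.Relation.Unary.All as AllV
import Data.Vec.Relation.Unary.All.Properties as AllV
open import Data.List
  using (List; []; _∷_; map; concatMap; filter; length; upTo; applyUpTo; applyDownFrom; reverse)
open import Data.List.Properties
  using (map-∘; map-id-local; length-map; filter-≐; map-concatMap; concatMap-map; concatMap-cong;
         map-upTo; reverse-applyDownFrom)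
import Data.List.Relation.Unary.All as All
open import Data.List.Relation.Unary.AllPairs using ([]; _∷_)
open import Data.List.Relation.Unary.Unique.Propositional using (Unique)
import Data.List.Relation.Unary.Unique.Propositional.Properties as Unique
import Data.List.Relation.Binary.Permutation.Propositional as ↭
open import Data.List.Relation.Binary.Permutation.Propositional
  using (_↭_; ↭-refl; ↭-trans; ↭-reflexive; module PermutationReasoning)
open import Data.List.Relation.Binary.Permutation.Propositional.Properties
  using (↭-length; filter-↭; ++⁺; ++⁺ˡ; shifts; map⁺; ↭-reverse)
open import Relation.Binary.PropositionalEquality
  using (_≡_; refl; sym; trans; cong; cong₂; subst; module ≡-Reasoning)
open import Relation.Nullary using (¬_; does)
open import Relation.Unary using (Pred; Decidable; _≐_)
open import Function using (_∘_)
open import Level using (Level)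
open import Data.Bool using (true; false)

private
  variable
    a b p q : Level
    A B : Set a

module _ {P : Pred B p} (P? : Decidable P) (f : A → B) where

  filter-map : ∀ xs → filter P? (map f xs) ≡ map f (filter (P? ∘ f) xs)
  filter-map []       = refl
  filter-map (x ∷ xs) with does (P? (f x))
  ... | true  = cong (f x ∷_) (filter-map xs)
  ... | false = filter-map xs

module _ {P : Pred A p} {Q : Pred A q} (P? : Decidable P) (Q? : Decidable Q) where

  length-filter-invariant : (f : A → A) → P ≐ Q ∘ f → ∀ {xs} → map f xs ↭ xs →
                            length (filter P? xs) ≡ length (filter Q? xs)
  length-filter-invariant f P≐Q∘f {xs} fxs↭xs = begin
    length (filter P? xs)                ≡⟨ cong length (filter-≐ P? (Q? ∘ f) P≐Q∘f xs) ⟩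
    length (filter (Q? ∘ f) xs)          ≡⟨ sym (length-map f (filter (Q? ∘ f) xs)) ⟩
    length (map f (filter (Q? ∘ f) xs))  ≡⟨ cong length (sym (filter-map Q? f xs)) ⟩
    length (filter Q? (map f xs))        ≡⟨ ↭-length (filter-↭ Q? fxs↭xs) ⟩
    length (filter Q? xs)                ∎
    where open ≡-Reasoning

module _ (f : A → List B) where

  concatMap-↭ : ∀ {xs ys} → xs ↭ ys → concatMap f xs ↭ concatMap f ys
  concatMap-↭ ↭.refl         = ↭-refl
  concatMap-↭ (↭.prep x p)   = ++⁺ˡ (f x) (concatMap-↭ p)
  concatMap-↭ (↭.swap x y p) = ↭-trans (shifts (f x) (f y)) (++⁺ˡ (f y) (++⁺ˡ (f x) (concatMap-↭ p)))
  concatMap-↭ (↭.trans p p′) = ↭-trans (concatMap-↭ p) (concatMap-↭ p′)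

concatMap-↭-pointwise : {f g : A → List B} → (∀ x → f x ↭ g x) →
                        ∀ xs → concatMap f xs ↭ concatMap g xs
concatMap-↭-pointwise f↭g []       = ↭-refl
concatMap-↭-pointwise f↭g (x ∷ xs) = ++⁺ (f↭g x) (concatMap-↭-pointwise f↭g xs)

tuples-map : (g : ℕ → ℕ) → ∀ h xs → map (V.map g) (tuples h xs) ≡ tuples h (map g xs)
tuples-map g zero    xs = refl
tuples-map g (suc h) xs = begin
  map (V.map g) (concatMap (λ x → map (x V.∷_) (tuples h xs)) xs)
    ≡⟨ map-concatMap (V.map g) _ xs ⟩
  concatMap (λ x → map (V.map g) (map (x V.∷_) (tuples h xs))) xs
    ≡⟨ concatMap-cong (λ x → sym (map-∘ (tuples h xs))) xs ⟩
  concatMap (λ x → map ((g x V.∷_) ∘ V.map g) (tuples h xs)) xs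
    ≡⟨ concatMap-cong (λ x → map-∘ {g = g x V.∷_} {f = V.map g} (tuples h xs)) xs ⟩
  concatMap (λ x → map (g x V.∷_) (map (V.map g) (tuples h xs))) xs
    ≡⟨ concatMap-cong (λ x → cong (map (g x V.∷_)) (tuples-map g h xs)) xs ⟩
  concatMap (λ x → map (g x V.∷_) (tuples h (map g xs))) xs
    ≡⟨ concatMap-map _ g xs ⟨
  concatMap (λ y → map (y V.∷_) (tuples h (map g xs))) (map g xs) ∎
  where open ≡-Reasoning

tuples-↭ : ∀ h {xs ys : List ℕ} → xs ↭ ys → tuples h xs ↭ tuples h ys
tuples-↭ zero    p = ↭-refl
tuples-↭ (suc h) {ys = ys} p = ↭-trans (concatMap-↭ _ p)
  (concatMap-↭-pointwise (λ y → map⁺ (y V.∷_) (tuples-↭ h p)) ys)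

applyUpTo-∸ : ∀ n → applyUpTo (n ∸_) n ≡ applyDownFrom suc n
applyUpTo-∸ zero    = refl
applyUpTo-∸ (suc n) = cong (suc n ∷_) (applyUpTo-∸ n)

reflect : ℕ → ℕ → ℕ
reflect j n = suc j ∸ n

InRange : ℕ → ℕ → Set
InRange j n = 1 ≤ n × n ≤ j

reflect-inRange : ∀ {j n} → InRange j n → InRange j (reflect j n)
reflect-inRange {j} (1≤n , n≤j) = m<n⇒0<n∸m (s≤s n≤j) , ∸-monoʳ-≤ (suc j) 1≤n

reflect-inRange⁻ : ∀ {j n} → InRange j (reflect j n) → InRange j n
reflect-inRange⁻ {n = zero}  (_ , 1+j≤j)  = ⊥-elim (1+n≰n 1+j≤j)
reflect-inRange⁻ {n = suc n} (1≤j∸n , _) = s≤s z≤n , m∸n≢0⇒n<m (<⇒≢ 1≤j∸n ∘ sym)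

reflect-involutive : ∀ {j n} → InRange j n → reflect j (reflect j n) ≡ n
reflect-involutive (_ , n≤j) = m∸[m∸n]≡n (m≤n⇒m≤1+n n≤j)

reflect-+ : ∀ {j n} → InRange j n → reflect j n + n ≡ suc j
reflect-+ (_ , n≤j) = m∸n+n≡m (m≤n⇒m≤1+n n≤j)

reflect-range1 : ∀ j → map (reflect j) (range1 j) ↭ range1 j
reflect-range1 j = begin
  map (reflect j) (map suc (upTo j))        ≡⟨ map-∘ (upTo j) ⟨
  map (j ∸_) (upTo j)                       ≡⟨ map-upTo (j ∸_) j ⟩
  applyUpTo (j ∸_) j                        ≡⟨ applyUpTo-∸ j ⟩
  applyDownFrom suc j                       ↭⟨ ↭-reverse (applyDownFrom suc j) ⟨
  reverse (applyDownFrom suc j)             ≡⟨ reverse-applyDownFrom suc j ⟩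
  applyUpTo suc j                           ≡⟨ map-upTo suc j ⟨
  map suc (upTo j)                          ∎
  where open PermutationReasoning

reflect-tuples : ∀ h j → map (V.map (reflect j)) (tuples h (range1 j)) ↭ tuples h (range1 j)
reflect-tuples h j =
  ↭-trans (↭-reflexive (tuples-map (reflect j) h (range1 j))) (tuples-↭ h (reflect-range1 j))

map-reflect-unique : ∀ {j xs} → All.All (InRange j) xs → Unique xs → Unique (map (reflect j) xs)
map-reflect-unique {j} {xs} xs∈[1,j] xs! = Unique.map⁻ (subst Unique (sym reflect²≡id) xs!)
  where
  reflect²≡id : map (reflect j) (map (reflect j) xs) ≡ xs
  reflect²≡id = trans (sym (map-∘ xs)) (map-id-local (All.map reflect-involutive xs∈[1,j]))

sum-map-complement : ∀ {h c} {f : ℕ → ℕ} {v : Vec ℕ h} →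
                     AllV.All (λ n → f n + n ≡ c) v → sum (V.map f v) + sum v ≡ h * c
sum-map-complement AllV.[] = refl
sum-map-complement {suc h} {c} {f} {x V.∷ v} (fx+x≡c AllV.∷ rest) = begin
  (f x + sum (V.map f v)) + (x + sum v)  ≡⟨ interchange (f x) (sum (V.map f v)) x (sum v) ⟩
  (f x + x) + (sum (V.map f v) + sum v)  ≡⟨ cong₂ _+_ fx+x≡c (sum-map-complement rest) ⟩
  c + h * c                              ∎
  where
  open ≡-Reasoning
  interchange : ∀ a b c d → (a + b) + (c + d) ≡ (a + c) + (b + d)
  interchange = solve-∀

sum-reflect : ∀ {h j} {v : Vec ℕ h} → AllV.All (InRange j) v →
              sum (V.map (reflect j) v) + sum v ≡ h * suc j
sum-reflect v∈[1,j] = sum-map-complement (AllV.map reflect-+ v∈[1,j])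

complement-equation : ∀ h j a b S S′ → S′ + S ≡ h * suc j → a + b ≡ 2 * h →
                      2 * S ≡ a * j + h → 2 * S′ ≡ b * j + h
complement-equation h j a b S S′ S′+S≡ a+b≡2h 2S≡ =
  +-cancelʳ-≡ (a * j + h) (2 * S′) (b * j + h) (begin
    2 * S′ + (a * j + h)   ≡⟨ cong (2 * S′ +_) 2S≡ ⟨
    2 * S′ + 2 * S         ≡⟨ *-distribˡ-+ 2 S′ S ⟨
    2 * (S′ + S)           ≡⟨ cong (2 *_) S′+S≡ ⟩
    2 * (h * suc j)        ≡⟨ expand h j ⟩
    2 * h * j + (h + h)    ≡⟨ cong (λ t → t * j + (h + h)) a+b≡2h ⟨
    (a + b) * j + (h + h)  ≡⟨ regroup a b j h ⟩
    b * j + h + (a * j + h) ∎)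
  where
  open ≡-Reasoning
  expand : ∀ h j → 2 * (h * suc j) ≡ 2 * h * j + (h + h)
  expand = solve-∀
  regroup : ∀ a b j h → (a + b) * j + (h + h) ≡ b * j + h + (a * j + h)
  regroup = solve-∀

module _ (h j k₁ k₂ : ℕ) (k₁+k₂≡2h : k₁ + k₂ ≡ 2 * h) where

  isSolution-reflect : ∀ {v} → IsSolution h j k₁ v → IsSolution h j k₂ (V.map (reflect j) v)
  isSolution-reflect {v} (v! , v∈[1,j] , 2Σv≡) =
    subst Unique (sym (V.toList-map (reflect j) v))
      (map-reflect-unique (AllV.toList⁺ v∈[1,j]) v!) ,
    AllV.gmap reflect-inRange v∈[1,j] ,
    complement-equation h j k₁ k₂ (sum v) (sum (V.map (reflect j) v))
      (sum-reflect v∈[1,j]) k₁+k₂≡2h 2Σv≡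

  isSolution-reflect⁻ : ∀ {v} → IsSolution h j k₂ (V.map (reflect j) v) → IsSolution h j k₁ v
  isSolution-reflect⁻ {v} (rv! , rv∈[1,j] , 2Σrv≡) =
    Unique.map⁻ (subst Unique (V.toList-map (reflect j) v) rv!) ,
    v∈[1,j] ,
    complement-equation h j k₂ k₁ (sum (V.map (reflect j) v)) (sum v)
      (trans (+-comm (sum v) _) (sum-reflect v∈[1,j])) (trans (+-comm k₂ k₁) k₁+k₂≡2h) 2Σrv≡
    where
    v∈[1,j] : AllV.All (InRange j) v
    v∈[1,j] = AllV.map reflect-inRange⁻ (AllV.map⁻ rv∈[1,j])

  numSolutions-complement : numSolutions h j k₁ ≡ numSolutions h j k₂
  numSolutions-complement =
    length-filter-invariant (isSolution? h j k₁) (isSolution? h j k₂) (V.map (reflect j))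
      (isSolution-reflect , isSolution-reflect⁻) (reflect-tuples h j)

sum-≤ : ∀ {h j} {v : Vec ℕ h} → AllV.All (_≤ j) v → sum v ≤ h * j
sum-≤ AllV.[]          = z≤n
sum-≤ (x≤j AllV.∷ v≤j) = +-mono-≤ x≤j (sum-≤ v≤j)

no-solution-2h≤k : ∀ {h j k v} → 1 ≤ h → 2 * h ≤ k → ¬ IsSolution h j k v
no-solution-2h≤k {h} {j} {k} {v} 1≤h 2h≤k (_ , v∈[1,j] , 2Σv≡) = n≮n (k * j) (begin-strict
  k * j        <⟨ m<m+n (k * j) 1≤h ⟩
  k * j + h    ≡⟨ 2Σv≡ ⟨
  2 * sum v    ≤⟨ *-monoʳ-≤ 2 (sum-≤ (AllV.map proj₂ v∈[1,j])) ⟩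
  2 * (h * j)  ≡⟨ *-assoc 2 h j ⟨
  2 * h * j    ≤⟨ *-monoˡ-≤ j 2h≤k ⟩
  k * j        ∎)
  where open ≤-Reasoning

pattern 1∈[1,2] = s≤s z≤n , s≤s z≤n
pattern 2∈[1,2] = s≤s z≤n , s≤s (s≤s z≤n)

inRange-2-pigeonhole : ∀ {x y z} → InRange 2 x → InRange 2 y → InRange 2 z →
                       x ≡ y ⊎ x ≡ z ⊎ y ≡ z
inRange-2-pigeonhole 1∈[1,2] 1∈[1,2] _       = inj₁ refl
inRange-2-pigeonhole 2∈[1,2] 2∈[1,2] _       = inj₁ refl
inRange-2-pigeonhole 1∈[1,2] 2∈[1,2] 1∈[1,2] = inj₂ (inj₁ refl)
inRange-2-pigeonhole 1∈[1,2] 2∈[1,2] 2∈[1,2] = inj₂ (inj₂ refl)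
inRange-2-pigeonhole 2∈[1,2] 1∈[1,2] 1∈[1,2] = inj₂ (inj₂ refl)
inRange-2-pigeonhole 2∈[1,2] 1∈[1,2] 2∈[1,2] = inj₂ (inj₁ refl)

no-solution-j≡2 : ∀ {h} (v : Vec ℕ h) → ¬ IsSolution h 2 1 v
no-solution-j≡2 V.[] (_ , _ , ())
no-solution-j≡2 (x V.∷ V.[]) (_ , (1∈[1,2] AllV.∷ _) , ())
no-solution-j≡2 (x V.∷ V.[]) (_ , (2∈[1,2] AllV.∷ _) , ())
no-solution-j≡2 (x V.∷ y V.∷ V.[]) ((x≢y All.∷ _) ∷ _ , (1∈[1,2] AllV.∷ 1∈[1,2] AllV.∷ _) , _) =
  x≢y refl
no-solution-j≡2 (x V.∷ y V.∷ V.[]) (_ , (1∈[1,2] AllV.∷ 2∈[1,2] AllV.∷ _) , ())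
no-solution-j≡2 (x V.∷ y V.∷ V.[]) (_ , (2∈[1,2] AllV.∷ 1∈[1,2] AllV.∷ _) , ())
no-solution-j≡2 (x V.∷ y V.∷ V.[]) (_ , (2∈[1,2] AllV.∷ 2∈[1,2] AllV.∷ _) , ())
no-solution-j≡2 (x V.∷ y V.∷ z V.∷ v)
  ((x≢y All.∷ x≢z All.∷ _) ∷ (y≢z All.∷ _) ∷ _ , (x∈ AllV.∷ y∈ AllV.∷ z∈ AllV.∷ _) , _)
  with inRange-2-pigeonhole x∈ y∈ z∈
... | inj₁ x≡y        = x≢y x≡y
... | inj₂ (inj₁ x≡z) = x≢z x≡z
... | inj₂ (inj₂ y≡z) = y≢z y≡z

0<k<j<3⇒j≡2∧k≡1 : ∀ {j k} → 1 ≤ k → k < j → j < 3 → j ≡ 2 × k ≡ 1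
0<k<j<3⇒j≡2∧k≡1 (s≤s z≤n) (s≤s (s≤s z≤n))     (s≤s (s≤s (s≤s z≤n))) = refl , refl
0<k<j<3⇒j≡2∧k≡1 (s≤s z≤n) (s≤s (s≤s (s≤s _))) (s≤s (s≤s (s≤s ())))

proposition10p1 :
    ((h j k : ℕ) → 1 ≤ h → 1 ≤ j → 1 ≤ k → k < j →
       (j < 3 ⊎ 2 * h ≤ k) → ¬ Σ (Vec ℕ h) (IsSolution h j k))
    ×
    ((h j k₁ M : ℕ) → 1 ≤ k₁ → k₁ < h → h < j →
       numSolutions h j k₁ ≡ M → numSolutions h j (2 * h ∸ k₁) ≡ M)
proposition10p1 = no-solution , same-count
  where
  no-solution : (h j k : ℕ) → 1 ≤ h → 1 ≤ j → 1 ≤ k → k < j →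
                (j < 3 ⊎ 2 * h ≤ k) → ¬ Σ (Vec ℕ h) (IsSolution h j k)
  no-solution h j k _ _ 1≤k k<j (inj₁ j<3) (v , sol) with 0<k<j<3⇒j≡2∧k≡1 1≤k k<j j<3
  ... | refl , refl = no-solution-j≡2 v sol
  no-solution h j k 1≤h _ _ _ (inj₂ 2h≤k) (v , sol) = no-solution-2h≤k 1≤h 2h≤k sol

  same-count : (h j k₁ M : ℕ) → 1 ≤ k₁ → k₁ < h → h < j →
               numSolutions h j k₁ ≡ M → numSolutions h j (2 * h ∸ k₁) ≡ M
  same-count h j k₁ M _ k₁<h _ refl =
    sym (numSolutions-complement h j k₁ (2 * h ∸ k₁) (m+[n∸m]≡n k₁≤2h))
    where
    k₁≤2h : k₁ ≤ 2 * h
    k₁≤2h = ≤-trans (<⇒≤ k₁<h) (m≤n*m h 2)
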